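{- Let $\mathcal{C} = (E, \mathcal{A}, \pi, \mathit{ok}, \vdash, \Vdash)$ be a contract. If an agreement on $\mathcal{C}$ exists, then for every participant $A \in \mathcal{A}$ and every $X \subseteq E$, either $\mathit{ok}(A, X)$ holds, or some participant is culpable in $X$.
   Context: A contract is a 6-tuple $\mathcal{C} = (E, \mathcal{A}, \pi, \mathit{ok}, \vdash, \Vdash)$ where $E$ is a finite set of events, $\mathcal{A}$ is a finite set of participants, $\pi : E \to \mathcal{A}$ assigns each event to a participant, $\mathit{ok} \subseteq \mathcal{A} \times \mathcal{P}(E)$ (the fulfillment relation) satisfies $\mathit{ok}(A,X) \wedge X \subseteq Y \Rightarrow \mathit{ok}(A,Y)$, and $\vdash, \Vdash \subseteq \mathcal{P}(E) \times E$ (enabling and circular enabling) are saturated: $X \circ e$ and $X \subseteq Y$ imply $Y \circ e$ for $\circ \in \{\vdash, \Vdash\}$. A set $C \subseteq E$ is a configuration of $\mathcal{C}$ iff there exist $e_0, \ldots, e_n$ with $\{e_0,\ldots,e_n\} = C$ such that for every $i \le n$, either $\{e_0,\ldots,e_{i-1}\} \vdash e_i$ or $C \Vdash e_i$. An agreement on $\mathcal{C}$ is a configuration $C$ such that $\mathit{ok}(A, C)$ for all $A \in \mathcal{A}$. For a participant $A$ and a set $X \subseteq E$, $\mathrm{duties}(A, X)$ is the set of events $e \notin X$ with $\pi(e) = A$ for which there exists a configuration $C$ of $\mathcal{C}$ with $e \in C$ such that either $X \vdash e$, or [there is no $e' \in C \setminus X$ with $X \vdash e'$, and there exists $D \subseteq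 C \cup X$ with $D \Vdash e$]. A participant $A$ is culpable in $X$ when $\mathrm{duties}(A,X) \neq \emptyset$. -}

module Defs where

open import Data.Nat using (ℕ)
open import Data.Fin using (Fin; toℕ)
open import Data.Fin.Subset using (Subset; _∈_; _∉_; _⊆_; _∪_; ⁅_⁆; ⊥)
open import Data.Bool using (Bool; T)
open import Data.List using (List; []; _∷_; foldr; length; take; lookup)
open import Data.Product using (Σ; ∃; _×_; _,_)
open import Data.Sum using (_⊎_)
open import Relation.Nullary using (¬_)
open import Relation.Binary.PropositionalEquality using (_≡_)

-- A contract with events E = Fin n and participants 𝒜 = Fin m.
record Contract (n m : ℕ) : Set where
  field
    π      : Fin n → Fin m
    ok     : Fin m → Subset n → Bool
    ⊢      : Subset n → Fin n → Bool
    ⊩      : Subset n → Fin n → Bool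
    ok-mono : ∀ (A : Fin m) (X Y : Subset n) → T (ok A X) → X ⊆ Y → T (ok A Y)
    ⊢-sat   : ∀ (X Y : Subset n) (e : Fin n) → T (⊢ X e) → X ⊆ Y → T (⊢ Y e)
    ⊩-sat   : ∀ (X Y : Subset n) (e : Fin n) → T (⊩ X e) → X ⊆ Y → T (⊩ Y e)

setOf : ∀ {n} → List (Fin n) → Subset n
setOf = foldr (λ e S → ⁅ e ⁆ ∪ S) ⊥

module _ {n m : ℕ} (𝒞 : Contract n m) where
  open Contract 𝒞

  IsConfiguration : Subset n → Set
  IsConfiguration C =
    Σ (List (Fin n)) λ es →
      (setOf es ≡ C) ×
      (∀ (i : Fin (length es)) →
         T (⊢ (setOf (take (toℕ i) es)) (lookup es i)) ⊎ T (⊩ C (lookup es i)))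

  IsAgreement : Subset n → Set
  IsAgreement C = IsConfiguration C × (∀ (A : Fin m) → T (ok A C))

  IsDuty : Fin m → Subset n → Fin n → Set
  IsDuty A X e =
    e ∉ X × π e ≡ A ×
    Σ (Subset n) λ C → IsConfiguration C × e ∈ C ×
      (T (⊢ X e) ⊎
       ((¬ Σ (Fin n) λ e′ → e′ ∈ C × e′ ∉ X × T (⊢ X e′)) ×
        Σ (Subset n) λ D → D ⊆ (C ∪ X) × T (⊩ D e)))

  Culpable : Fin m → Subset n → Set
  Culpable A X = ∃ λ e → IsDuty A X e

module Submission where

-- Let C be an agreement, enumerated as e₀ … e_k by its
-- configuration witness.  Either some event e ∈ C ∖ X is enabled by X (a
-- duty of π e by the first clause), or some e ∈ C ∖ X is circularly enabled
-- by C (a duty of π e by the second clause, taking D = C, since no event of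
-- C ∖ X is enabled by X).  Otherwise X is "closed within C": every event of
-- C enabled by X or circularly by C is already in X.  Walking along the
-- enumeration, each eᵢ is enabled by its prefix (which lies in X by
-- induction, hence by saturation X ⊢ eᵢ) or circularly by C, so C ⊆ X;
-- monotonicity of ok then turns ok(A, C) into ok(A, X).

open import Defs
open import Data.Nat using (ℕ)
open import Data.Fin using (Fin; toℕ; zero; suc)
open import Data.Fin.Subset using (Subset; _∈_; _∉_; _⊆_; _∪_; ⁅_⁆; ⊥)
open import Data.Fin.Subset.Properties
  using (_∈?_; x∈p∪q⁻; x∈p∪q⁺; x∈⁅x⁆; x∈⁅y⁆⇒x≡y; p⊆p∪q; q⊆p∪q; ∉⊥; ⊆-reflexive; ∪-identityʳ)
open import Data.Fin.Properties using (any?)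
open import Data.Bool using (T)
open import Data.List using (List; []; _∷_; length; take; lookup)
open import Data.Product using (∃; Σ; _×_; _,_)
open import Data.Sum using (_⊎_; inj₁; inj₂; map)
open import Relation.Nullary using (¬_; yes; no; contradiction)
open import Relation.Nullary.Decidable using (T?; _×-dec_; ¬?)
open import Relation.Binary.PropositionalEquality using (refl)

∪-least : ∀ {n} {p q r : Subset n} → p ⊆ r → q ⊆ r → p ∪ q ⊆ r
∪-least {p = p} {q} p⊆r q⊆r x∈p∪q with x∈p∪q⁻ p q x∈p∪q
... | inj₁ x∈p = p⊆r x∈p
... | inj₂ x∈q = q⊆r x∈q

⁅⁆⊆ : ∀ {n} {y : Fin n} {r : Subset n} → y ∈ r → ⁅ y ⁆ ⊆ r
⁅⁆⊆ {y = y} y∈r x∈⁅y⁆ with x∈⁅y⁆⇒x≡y y x∈⁅y⁆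
... | refl = y∈r

module _ {n m : ℕ} (𝒞 : Contract n m) where
  open Contract 𝒞

  enabledDuty : ∀ {C X : Subset n} {e : Fin n} → IsConfiguration 𝒞 C →
    e ∈ C → e ∉ X → T (⊢ X e) → IsDuty 𝒞 (π e) X e
  enabledDuty conf e∈C e∉X X⊢e = e∉X , refl , _ , conf , e∈C , inj₁ X⊢e

  circularDuty : ∀ {C X : Subset n} {e : Fin n} → IsConfiguration 𝒞 C →
    (¬ Σ (Fin n) λ e′ → e′ ∈ C × e′ ∉ X × T (⊢ X e′)) →
    e ∈ C → e ∉ X → T (⊩ C e) → IsDuty 𝒞 (π e) X e
  circularDuty {C} {X} conf stuck e∈C e∉X C⊩e =
    e∉X , refl , C , conf , e∈C , inj₂ (stuck , C , p⊆p∪q X , C⊩e)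

  ClosedWithin : Subset n → Subset n → Set
  ClosedWithin C X =
    ∀ e → e ∈ C → T (⊢ X e) ⊎ T (⊩ C e) → e ∈ X

  module _ {C X : Subset n} (closed : ClosedWithin C X) where

    -- This weakening of the configuration condition
    -- is stable under dropping a head that already lies in X.
    EnabledOver : List (Fin n) → Set
    EnabledOver ys = ∀ (i : Fin (length ys)) →
      T (⊢ (X ∪ setOf (take (toℕ i) ys)) (lookup ys i)) ⊎ T (⊩ C (lookup ys i))

    enumeration⊆ : ∀ ys → setOf ys ⊆ C → EnabledOver ys → setOf ys ⊆ X
    enumeration⊆ [] _ _ x∈⊥ = contradiction x∈⊥ ∉⊥
    enumeration⊆ (y ∷ ys) ys⊆C enabled =
      ∪-least (⁅⁆⊆ y∈X) (enumeration⊆ ys (λ z → ys⊆C (q⊆p∪q ⁅ y ⁆ _ z)) enabledTail)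
      where
      y∈X : y ∈ X
      y∈X with enabled zero
      ... | inj₁ X∪⊥⊢y = closed y (ys⊆C (p⊆p∪q _ (x∈⁅x⁆ y)))
                           (inj₁ (⊢-sat _ X y X∪⊥⊢y (⊆-reflexive (∪-identityʳ X))))
      ... | inj₂ C⊩y   = closed y (ys⊆C (p⊆p∪q _ (x∈⁅x⁆ y))) (inj₂ C⊩y)

      -- Since y ∈ X, adding y to the prefix does not enlarge X ∪ prefix.
      enabledTail : EnabledOver ys
      enabledTail i with enabled (suc i)
      ... | inj₁ X⊢e = inj₁ (⊢-sat _ _ _ X⊢e
                         (∪-least (p⊆p∪q _) (∪-least (⁅⁆⊆ (p⊆p∪q _ y∈X)) (q⊆p∪q X _))))
      ... | inj₂ C⊩e = inj₂ C⊩e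

    configuration⊆ : IsConfiguration 𝒞 C → C ⊆ X
    configuration⊆ (es , refl , steps) =
      enumeration⊆ es (λ z → z) λ i → map
        (λ ⊢e → ⊢-sat _ _ _ ⊢e (q⊆p∪q X _)) (λ ⊩e → ⊩e) (steps i)

  culpableOrClosed : ∀ {C : Subset n} (X : Subset n) → IsConfiguration 𝒞 C →
    ∃ (λ B → Culpable 𝒞 B X) ⊎ ClosedWithin C X
  culpableOrClosed {C} X conf
    with any? (λ e → (e ∈? C) ×-dec (¬? (e ∈? X) ×-dec T? (⊢ X e)))
  ... | yes (e , e∈C , e∉X , X⊢e) = inj₁ (π e , e , enabledDuty conf e∈C e∉X X⊢e)
  ... | no stuck with any? (λ e → (e ∈? C) ×-dec (¬? (e ∈? X) ×-dec T? (⊩ C e)))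
  ...   | yes (e , e∈C , e∉X , C⊩e) =
            inj₁ (π e , e , circularDuty conf stuck e∈C e∉X C⊩e)
  ...   | no noCircular = inj₂ closed
    where
    closed : ClosedWithin C X
    closed e e∈C enabled with e ∈? X
    ... | yes e∈X = e∈X
    ... | no e∉X with enabled
    ...   | inj₁ X⊢e = contradiction (e , e∈C , e∉X , X⊢e) stuck
    ...   | inj₂ C⊩e = contradiction (e , e∈C , e∉X , C⊩e) noCircular

theorem1 : ∀ {n m : ℕ} (𝒞 : Contract n m) →
    ∃ (IsAgreement 𝒞) →
    ∀ (A : Fin m) (X : Subset n) →
    T (Contract.ok 𝒞 A X) ⊎ ∃ (λ B → Culpable 𝒞 B X)
theorem1 𝒞 (C , conf , okC) A X with culpableOrClosed 𝒞 X conf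
... | inj₁ culprit = inj₂ culprit
... | inj₂ closed  =
  inj₁ (Contract.ok-mono 𝒞 A C X (okC A) (configuration⊆ 𝒞 closed conf))
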